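{- For any graph $G$ of order $n$ with vertex connectivity $\kappa$, $\mathrm{th}^*_{\mathrm{H}}(G)\geq \left\lceil \frac{n+\kappa}{2}\right\rceil$.
   Context: All graphs are finite, simple and undirected; $N(v)$ is the open neighborhood of $v$. Vertices are colored blue or white. Under the hopping color change rule, a blue vertex $v$ may force a white vertex $w$ (not necessarily adjacent to $v$) to become blue provided $v$ has not previously performed a force and every vertex of $N(v)$ is blue. Starting from an initial blue set $B\subseteq V(G)$, a chronological list of forces is a sequence of valid forces performed one at a time until no further force is possible; its unordered set of forces is a set of forces of $B$. $B$ is a hopping forcing set if some chronological list turns every vertex blue; $\mathrm{H}(G)$ is the minimum size of a hopping forcing set. For a set of forces $\mathcal F$ of $B$, put $\mathcal F^{(0)}=B$ and, for $t>0$, let $\mathcal F^{(t)}$ be the set of vertices $w$ for which there is a force $v\to w$ in $\mathcal F$ with $v\in\bigcup_{i<t}\mathcal F^{(i)}$ that is a valid hopping force when exactly the vertices of $\bigcup_{i<t}\mathcal F^{(i)}$ are blue. $\mathrm{pt}_{\mathrm{H}}(G;\mathcal F)$ is the least $t$ with $\bigcup_{i\le t}\mathcal F^{(i)}=V(G)$, and $\mathrm{pt}_{\mathrm{H}}(G;B)$ is the minimum of $\mathrm{pt}_{\mathrm{H}}(G;\mathcal F)$ over sets of forces $\mathcal F$ of $B$ ($\infty$ if $B$ is not a hopping forcing set). For an integer $k$, $\mathrm{pt}_{\mathrm{H}}(G,k)=\min\{\mathrm{pt}_{\mathrm{H}}(G;B): B\subseteq V(G),\ |B|=k\}$. The product hopping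 throttling number without initial cost is $\mathrm{th}^*_{\mathrm{H}}(G)=\min_{\mathrm{H}(G)\leq k<|V(G)|}\{k\cdot \mathrm{pt}_{\mathrm{H}}(G,k)\}$ (equal to $\infty$ when this minimum is over an empty range or all values are infinite). -}

module Defs where

open import Level using (0ℓ)
open import Data.Nat using (ℕ; zero; suc; _+_; _*_; _∸_; _≤_; _<_)
open import Data.Fin using (Fin)
open import Data.Fin.Subset using (Subset; _∈_; _∉_; ∣_∣)
open import Data.List using (List; []; _∷_)
open import Data.List.Membership.Propositional
  renaming (_∈_ to _∈L_; _∉_ to _∉L_)
open import Data.Product using (Σ; ∃; ∃-syntax; _×_; _,_)
open import Data.Sum using (_⊎_)
open import Relation.Nullary using (¬_)
open import Relation.Binary.PropositionalEquality using (_≡_)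

record Graph (n : ℕ) : Set₁ where
  field
    Adj   : Fin n → Fin n → Set
    sym   : ∀ {u v} → Adj u v → Adj v u
    irrefl : ∀ {u} → ¬ Adj u u
open Graph public

data Reach {n : ℕ} (G : Graph n) (S : Subset n) (x : Fin n) : Fin n → Set where
  here : x ∉ S → Reach G S x x
  step : ∀ {y z} → Reach G S x y → Adj G y z → z ∉ S → Reach G S x z

DisconnectedOrTrivial : ∀ {n} → Graph n → Subset n → Set
DisconnectedOrTrivial {n} G S =
  (n ∸ ∣ S ∣ ≤ 1) ⊎ (∃[ x ] ∃[ y ] (x ∉ S × y ∉ S × ¬ Reach G S x y))

IsConnectivity : ∀ {n} → Graph n → ℕ → Set
IsConnectivity {n} G κ =
  (∃[ S ] (∣ S ∣ ≡ κ × DisconnectedOrTrivial G S))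
  × (∀ S → DisconnectedOrTrivial G S → κ ≤ ∣ S ∣)

-- v may force w (hopping rule) when `blue` is the blue set and `used`
-- are the vertices that have already forced.
CanForce : ∀ {n} → Graph n → (Fin n → Set) → List (Fin n) → Fin n → Fin n → Set
CanForce G blue used v w =
  blue v × v ∉L used × ¬ blue w × (∀ u → Adj G v u → blue u)

ChronFrom : ∀ {n} → Graph n → (Fin n → Set) → List (Fin n) → List (Fin n × Fin n) → Set
ChronFrom G blue used [] = ¬ (∃[ v ] ∃[ w ] CanForce G blue used v w)
ChronFrom G blue used ((v , w) ∷ L) =
  CanForce G blue used v w × ChronFrom G (λ x → blue x ⊎ x ≡ w) (v ∷ used) L

Chron : ∀ {n} → Graph n → Subset n → List (Fin n × Fin n) → Set
Chron G B L = ChronFrom G (λ x → x ∈ B) [] L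

IsHFS : ∀ {n} → Graph n → Subset n → Set
IsHFS G B = ∃[ L ] (Chron G B L × (∀ x → x ∈ B ⊎ ∃[ v ] ((v , x) ∈L L)))

IsH : ∀ {n} → Graph n → ℕ → Set
IsH G h = (∃[ B ] (∣ B ∣ ≡ h × IsHFS G B)) × (∀ B → IsHFS G B → h ≤ ∣ B ∣)

-- Propagation time.  The set of forces F is represented by (the
-- membership of) a chronological list L.  Stage G B L t x means
-- x ∈ F^(0) ∪ ... ∪ F^(t).

Stage : ∀ {n} → Graph n → Subset n → List (Fin n × Fin n) → ℕ → Fin n → Set
Stage G B L zero x = x ∈ B
Stage G B L (suc t) x =
  Stage G B L t x
  ⊎ (∃[ v ] ((v , x) ∈L L × Stage G B L t v
             × (∀ u → Adj G v u → Stage G B L t u) × ¬ Stage G B L t x))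

PtF : ∀ {n} → Graph n → Subset n → List (Fin n × Fin n) → ℕ → Set
PtF G B L t = (∀ x → Stage G B L t x) × (∀ t' → (∀ x → Stage G B L t' x) → t ≤ t')

PtB : ∀ {n} → Graph n → Subset n → ℕ → Set
PtB G B t = (∃[ L ] (Chron G B L × PtF G B L t))
  × (∀ L t' → Chron G B L → PtF G B L t' → t ≤ t')

PtK : ∀ {n} → Graph n → ℕ → ℕ → Set
PtK G k t = (∃[ B ] (∣ B ∣ ≡ k × PtB G B t))
  × (∀ B t' → ∣ B ∣ ≡ k → PtB G B t' → t ≤ t')

-- m is one of the (finite) values k · pt_H(G,k) with H(G) ≤ k < n
-- over which th*_H(G) is the minimum.
ThStarCandidate : ∀ {n} → Graph n → ℕ → Set
ThStarCandidate {n} G m =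
  ∃[ h ] ∃[ k ] ∃[ t ] (IsH G h × h ≤ k × k < n × PtK G k t × m ≡ k * t)

-- th*_H(G) ≥ c  (true vacuously when th*_H(G) = ∞).
ThStarAtLeast : ∀ {n} → Graph n → ℕ → Set
ThStarAtLeast G c = ∀ m → ThStarCandidate G m → c ≤ m

-- Let B, with |B| = k < n, propagate in t rounds; t ≥ 1 since some vertex starts white.
-- Each vertex forces at most once, and a vertex entering in round s + 1 is forced by a
-- vertex blue after s rounds, so at most k + (number blue after s rounds) are blue after
-- s + 1 rounds; hence n ≤ k (t + 1).  The c vertices forced in round one have forcers
-- X ⊆ B with |X| = c whose neighbourhoods lie in B, so B ∖ X separates X from every white
-- vertex and κ ≤ k − c.  For t = 1 we have n ≤ k + c, so n + κ ≤ 2k; for t ≥ 2,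
-- n + κ ≤ k (t + 1) + k ≤ 2kt.

module Submission where

open import Defs hiding (sym)

open import Function using (_∘_)
open import Data.Nat using (ℕ; zero; suc; pred; _+_; _*_; _≤_; _<_; _≤′_; ≤′-refl; ≤′-step; z≤n; s≤s; ⌈_/2⌉)
open import Data.Nat.Properties
open import Data.Fin using (Fin)
import Data.Fin.Properties as Fin
open import Data.Fin.Subset using (Subset; inside; outside; _∈_; _∉_; _⊆_; ∣_∣; _∩_; ∁; ⊤; _-_)
open import Data.Fin.Subset.Properties
  using (_∈?_; ∣⊤∣≡n; p⊆q⇒∣p∣≤∣q∣; ∣p∩q∣≤∣q∣; x∈p∩q⁺; x∈p∩q⁻; x∈∁p⇒x∉p; x∉p⇒x∈∁p; x∉∁p⇒x∈p;
         x∈p∧x≢y⇒x∈p-y; x∈p⇒∣p-x∣<∣p∣)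
open import Data.Vec using ([]; _∷_; here; there; tabulate)
open import Data.Vec.Properties using (lookup∘tabulate; lookup⇒[]=; []=⇒lookup)
open import Data.List using (List; _∷_)
open import Data.List.Membership.Propositional using () renaming (_∈_ to _∈L_)
open import Data.List.Relation.Unary.Any using (here; there)
open import Data.Product using (∃; ∃-syntax; _×_; _,_; proj₁; proj₂)
open import Data.Sum using (inj₁; inj₂)
open import Relation.Nullary using (¬_; yes; no; does; contradiction)
open import Relation.Nullary.Decidable using (dec-true; _×-dec_)
open import Relation.Unary using (Pred; Decidable)
open import Relation.Binary.PropositionalEquality using (_≡_; refl; sym; trans; cong; cong₂; subst)

module _ {n ℓ} {P : Pred (Fin n) ℓ} (P? : Decidable P) where

  subsetOf : Subset n
  subsetOf = tabulate (does ∘ P?)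

  ∈subsetOf⁺ : ∀ {x} → P x → x ∈ subsetOf
  ∈subsetOf⁺ {x} px =
    lookup⇒[]= x subsetOf (trans (lookup∘tabulate (does ∘ P?) x) (dec-true (P? x) px))

  ∈subsetOf⁻ : ∀ {x} → x ∈ subsetOf → P x
  ∈subsetOf⁻ {x} x∈ with P? x | trans (sym (lookup∘tabulate (does ∘ P?) x)) ([]=⇒lookup x∈)
  ... | yes px | _ = px

∣p∩∁q∣+∣p∩q∣≡∣p∣ : ∀ {n} (p q : Subset n) → ∣ p ∩ ∁ q ∣ + ∣ p ∩ q ∣ ≡ ∣ p ∣
∣p∩∁q∣+∣p∩q∣≡∣p∣ []            []            = refl
∣p∩∁q∣+∣p∩q∣≡∣p∣ (outside ∷ p) (_       ∷ q) = ∣p∩∁q∣+∣p∩q∣≡∣p∣ p q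
∣p∩∁q∣+∣p∩q∣≡∣p∣ (inside  ∷ p) (outside ∷ q) = cong suc (∣p∩∁q∣+∣p∩q∣≡∣p∣ p q)
∣p∩∁q∣+∣p∩q∣≡∣p∣ (inside  ∷ p) (inside  ∷ q) = trans (+-suc _ _) (cong suc (∣p∩∁q∣+∣p∩q∣≡∣p∣ p q))

∣p∣≤∣q∣+∣p∩∁q∣ : ∀ {n} (p q : Subset n) → ∣ p ∣ ≤ ∣ q ∣ + ∣ p ∩ ∁ q ∣
∣p∣≤∣q∣+∣p∩∁q∣ p q = begin
  ∣ p ∣                     ≡⟨ sym (∣p∩∁q∣+∣p∩q∣≡∣p∣ p q) ⟩
  ∣ p ∩ ∁ q ∣ + ∣ p ∩ q ∣   ≤⟨ +-monoʳ-≤ ∣ p ∩ ∁ q ∣ (∣p∩q∣≤∣q∣ p q) ⟩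
  ∣ p ∩ ∁ q ∣ + ∣ q ∣       ≡⟨ +-comm ∣ p ∩ ∁ q ∣ ∣ q ∣ ⟩
  ∣ q ∣ + ∣ p ∩ ∁ q ∣       ∎
  where open ≤-Reasoning

injectiveOn⇒∣p∣≤∣q∣ : ∀ {n m} {p : Subset n} {q : Subset m} (f : Fin n → Fin m) →
  (∀ {x} → x ∈ p → f x ∈ q) → (∀ {x y} → x ∈ p → y ∈ p → f x ≡ f y → x ≡ y) →
  ∣ p ∣ ≤ ∣ q ∣
injectiveOn⇒∣p∣≤∣q∣ {p = []} f maps inj = z≤n
injectiveOn⇒∣p∣≤∣q∣ {p = outside ∷ p} f maps inj =
  injectiveOn⇒∣p∣≤∣q∣ (f ∘ Fin.suc) (maps ∘ there)
    (λ x∈p y∈p eq → Fin.suc-injective (inj (there x∈p) (there y∈p) eq))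
injectiveOn⇒∣p∣≤∣q∣ {p = inside ∷ p} {q} f maps inj = begin-strict
  ∣ p ∣             ≤⟨ injectiveOn⇒∣p∣≤∣q∣ (f ∘ Fin.suc) mapsʳ
                         (λ x∈p y∈p eq → Fin.suc-injective (inj (there x∈p) (there y∈p) eq)) ⟩
  ∣ q - f Fin.zero ∣ <⟨ x∈p⇒∣p-x∣<∣p∣ (maps here) ⟩
  ∣ q ∣             ∎
  where
  open ≤-Reasoning
  mapsʳ : ∀ {x} → x ∈ p → f (Fin.suc x) ∈ q - f Fin.zero
  mapsʳ x∈p = x∈p∧x≢y⇒x∈p-y (maps (there x∈p))
    (λ eq → Fin.0≢1+n (inj here (there x∈p) (sym eq)))

chronFrom-fresh : ∀ {n} {G : Graph n} {blue used L v w} →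
  ChronFrom G blue used L → (v , w) ∈L L → ¬ v ∈L used
chronFrom-fresh {L = _ ∷ _} (canForce , _)    (here refl) = proj₁ (proj₂ canForce)
chronFrom-fresh {L = _ ∷ _} (_        , rest) (there vw∈L) v∈used =
  chronFrom-fresh rest vw∈L (there v∈used)

chronFrom-functional : ∀ {n} {G : Graph n} {blue used L v x y} →
  ChronFrom G blue used L → (v , x) ∈L L → (v , y) ∈L L → x ≡ y
chronFrom-functional _          (here refl)  (here refl)  = refl
chronFrom-functional (_ , rest) (here refl)  (there vy∈L) =
  contradiction (here refl) (chronFrom-fresh rest vy∈L)
chronFrom-functional (_ , rest) (there vx∈L) (here refl)  =
  contradiction (here refl) (chronFrom-fresh rest vx∈L)
chronFrom-functional (_ , rest) (there vx∈L) (there vy∈L) = chronFrom-functional rest vx∈L vy∈L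

module Stages {n} (G : Graph n) (B : Subset n) (L : List (Fin n × Fin n)) where

  Blue : ℕ → Fin n → Set
  Blue = Stage G B L

  Forces : ℕ → Fin n → Fin n → Set
  Forces r v x = (v , x) ∈L L × Blue r v × (∀ u → Adj G v u → Blue r u) × ¬ Blue r x

  blue-mono : ∀ {s s' x} → s ≤ s' → Blue s x → Blue s' x
  blue-mono = go ∘ ≤⇒≤′
    where
    go : ∀ {s s' x} → s ≤′ s' → Blue s x → Blue s' x
    go ≤′-refl        = λ b → b
    go (≤′-step s≤s') = inj₁ ∘ go s≤s'

  data EntersAt (x : Fin n) : ℕ → Set where
    initially : x ∈ B → EntersAt x 0
    forcedBy  : ∀ {r} v → Forces r v x → EntersAt x (suc r)

  entry : ∀ s {x} → Blue s x → ∃[ r ] EntersAt x r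
  entry zero    x∈B                = 0 , initially x∈B
  entry (suc s) (inj₁ b)           = entry s b
  entry (suc s) (inj₂ (v , forces)) = suc s , forcedBy v forces

  entersAt-least : ∀ {x r s} → EntersAt x r → Blue s x → r ≤ s
  entersAt-least (initially _) _ = z≤n
  entersAt-least {r = suc r} {s} (forcedBy _ (_ , _ , _ , ¬blue)) b with s ≤? r
  ... | yes s≤r = contradiction (blue-mono s≤r b) ¬blue
  ... | no  s≰r = ≰⇒> s≰r

  -- junk value for an initially blue x
  forcerOf : ∀ {x r} → EntersAt x r → Fin n
  forcerOf {x} (initially _)  = x
  forcerOf     (forcedBy v _) = v

  forcerOf-forces : ∀ {x r} (e : EntersAt x r) → x ∉ B → Forces (pred r) (forcerOf e) x
  forcerOf-forces (initially x∈B)     x∉B = contradiction x∈B x∉B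
  forcerOf-forces (forcedBy _ forces) _   = forces

  entersAt-∉⇒>0 : ∀ {x r} → EntersAt x r → x ∉ B → 0 < r
  entersAt-∉⇒>0 (initially x∈B) x∉B = contradiction x∈B x∉B
  entersAt-∉⇒>0 (forcedBy _ _)  _   = s≤s z≤n

  noFirstRound⇒blue⊆B : (∀ {v x} → ¬ Forces 0 v x) → ∀ s {x} → Blue s x → x ∈ B
  noFirstRound⇒blue⊆B none zero    x∈B = x∈B
  noFirstRound⇒blue⊆B none (suc s) (inj₁ b) = noFirstRound⇒blue⊆B none s b
  noFirstRound⇒blue⊆B none (suc s) {x} (inj₂ (v , vx∈L , bv , bnbrs , _)) with x ∈? B
  ... | yes x∈B = x∈B
  ... | no  x∉B = contradiction (vx∈L , blue⊆B bv , (λ u → blue⊆B ∘ bnbrs u) , x∉B) none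
    where
    blue⊆B : ∀ {y} → Blue s y → y ∈ B
    blue⊆B = noFirstRound⇒blue⊆B none s

∃∉⇐∣p∣<n : ∀ {n} {p : Subset n} → ∣ p ∣ < n → ∃ λ x → x ∉ p
∃∉⇐∣p∣<n {n} {p} ∣p∣<n = Fin.¬∀⟶∃¬ n (_∈ p) (_∈? p) λ all∈p →
  <⇒≱ ∣p∣<n (subst (_≤ ∣ p ∣) (∣⊤∣≡n n) (p⊆q⇒∣p∣≤∣q∣ {p = ⊤} (λ {x} _ → all∈p x)))

n+κ≤2kt : ∀ {n κ k c} t → 0 < t → n ≤ k * suc t → (t ≤ 1 → n ≤ k + c) → κ + c ≤ k →
  n + κ ≤ k * t + k * t
n+κ≤2kt {n} {κ} {k} {c} 1 _ _ n≤k+c κ+c≤k = begin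
  n + κ           ≤⟨ +-monoˡ-≤ κ (n≤k+c ≤-refl) ⟩
  k + c + κ       ≡⟨ +-assoc k c κ ⟩
  k + (c + κ)     ≡⟨ cong (k +_) (+-comm c κ) ⟩
  k + (κ + c)     ≤⟨ +-monoʳ-≤ k κ+c≤k ⟩
  k + k           ≡⟨ sym (cong₂ _+_ (*-identityʳ k) (*-identityʳ k)) ⟩
  k * 1 + k * 1   ∎
  where open ≤-Reasoning
n+κ≤2kt {n} {κ} {k} t@(suc (suc t′)) _ n≤k*suc-t _ κ+c≤k = begin
  n + κ               ≤⟨ +-mono-≤ n≤k*suc-t (m+n≤o⇒m≤o κ κ+c≤k) ⟩
  k * suc t + k       ≡⟨ +-comm (k * suc t) k ⟩
  k + k * suc t       ≡⟨ sym (*-suc k (suc t)) ⟩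
  k * suc (suc t)     ≤⟨ *-monoʳ-≤ k (s≤s (s≤s (m≤n+m t t′))) ⟩
  k * (t + t)         ≡⟨ *-distribˡ-+ k t t ⟩
  k * t + k * t       ∎
  where open ≤-Reasoning

separates : ∀ {n} (G : Graph n) {B X : Subset n} → X ⊆ B →
  (∀ {y u} → y ∈ X → Adj G y u → u ∈ B) →
  ∀ {v w} → v ∈ X → w ∉ B → DisconnectedOrTrivial G (B ∩ ∁ X)
separates G {B} {X} X⊆B closed {v} {w} v∈X w∉B =
  inj₂ (v , w , v∉S , w∉B ∘ proj₁ ∘ x∈p∩q⁻ B (∁ X) , λ reach → w∉B (X⊆B (confined reach)))
  where
  v∉S : v ∉ B ∩ ∁ X
  v∉S v∈S = x∈∁p⇒x∉p (proj₂ (x∈p∩q⁻ B (∁ X) v∈S)) v∈X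
  confined : ∀ {z} → Reach G (B ∩ ∁ X) v z → z ∈ X
  confined (here _)                = v∈X
  confined (step reach adj z∉B∩∁X) =
    x∉∁p⇒x∈p (λ z∈∁X → z∉B∩∁X (x∈p∩q⁺ (closed (confined reach) adj , z∈∁X)))

module Rounds {n} {G : Graph n} {B : Subset n} {L : List (Fin n × Fin n)} (chron : Chron G B L)
              {t : ℕ} (allBlue : ∀ x → Stage G B L t x) where
  open Stages G B L

  round : Fin n → ℕ
  round x = proj₁ (entry t (allBlue x))

  forcer : Fin n → Fin n
  forcer x = forcerOf (proj₂ (entry t (allBlue x)))

  round-least : ∀ {s x} → Blue s x → round x ≤ s
  round-least {x = x} = entersAt-least (proj₂ (entry t (allBlue x)))

  forcer-forces : ∀ {x} → x ∉ B → Forces (pred (round x)) (forcer x) x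
  forcer-forces {x} = forcerOf-forces (proj₂ (entry t (allBlue x)))

  ∉B⇒round>0 : ∀ {x} → x ∉ B → 0 < round x
  ∉B⇒round>0 {x} = entersAt-∉⇒>0 (proj₂ (entry t (allBlue x)))

  round≤0⇒∈B : ∀ {x} → round x ≤ 0 → x ∈ B
  round≤0⇒∈B {x} round≤0 with x ∈? B
  ... | yes x∈B = x∈B
  ... | no  x∉B = contradiction round≤0 (<⇒≱ (∉B⇒round>0 x∉B))

  forcer-earlier : ∀ {x} → x ∉ B → round (forcer x) ≤ pred (round x)
  forcer-earlier x∉B = round-least (proj₁ (proj₂ (forcer-forces x∉B)))

  forcer-injective : ∀ {x y} → x ∉ B → y ∉ B → forcer x ≡ forcer y → x ≡ y
  forcer-injective x∉B y∉B eq = chronFrom-functional chron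
    (proj₁ (forcer-forces x∉B)) (subst (λ v → (v , _) ∈L L) (sym eq) (proj₁ (forcer-forces y∉B)))

  atMost : ℕ → Subset n
  atMost s = subsetOf (λ x → round x ≤? s)

  ∈atMost⁺ : ∀ {s x} → round x ≤ s → x ∈ atMost s
  ∈atMost⁺ {s} = ∈subsetOf⁺ (λ x → round x ≤? s)

  ∈atMost⁻ : ∀ {s x} → x ∈ atMost s → round x ≤ s
  ∈atMost⁻ {s} = ∈subsetOf⁻ (λ x → round x ≤? s)

  forcedWithin : ℕ → Subset n
  forcedWithin s = atMost s ∩ ∁ B

  forcedWithin-∉B : ∀ {s x} → x ∈ forcedWithin s → x ∉ B
  forcedWithin-∉B = x∈∁p⇒x∉p ∘ proj₂ ∘ x∈p∩q⁻ _ _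

  forcedWithin-round : ∀ {s x} → x ∈ forcedWithin s → round x ≤ s
  forcedWithin-round = ∈atMost⁻ ∘ proj₁ ∘ x∈p∩q⁻ _ _

  n≤∣atMost∣ : ∀ {s} → t ≤ s → n ≤ ∣ atMost s ∣
  n≤∣atMost∣ {s} t≤s = subst (_≤ ∣ atMost s ∣) (∣⊤∣≡n n)
    (p⊆q⇒∣p∣≤∣q∣ {p = ⊤} (λ {x} _ → ∈atMost⁺ (≤-trans (round-least (allBlue x)) t≤s)))

  ∣atMost∣≤∣B∣*suc : ∀ s → ∣ atMost s ∣ ≤ ∣ B ∣ * suc s
  ∣atMost∣≤∣B∣*suc zero = subst (∣ atMost 0 ∣ ≤_) (sym (*-identityʳ ∣ B ∣))
    (p⊆q⇒∣p∣≤∣q∣ (round≤0⇒∈B ∘ ∈atMost⁻))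
  ∣atMost∣≤∣B∣*suc (suc s) = begin
    ∣ atMost (suc s) ∣                ≤⟨ ∣p∣≤∣q∣+∣p∩∁q∣ (atMost (suc s)) B ⟩
    ∣ B ∣ + ∣ forcedWithin (suc s) ∣  ≤⟨ +-monoʳ-≤ ∣ B ∣ (injectiveOn⇒∣p∣≤∣q∣ forcer earlier injective) ⟩
    ∣ B ∣ + ∣ atMost s ∣              ≤⟨ +-monoʳ-≤ ∣ B ∣ (∣atMost∣≤∣B∣*suc s) ⟩
    ∣ B ∣ + ∣ B ∣ * suc s             ≡⟨ sym (*-suc ∣ B ∣ (suc s)) ⟩
    ∣ B ∣ * suc (suc s)               ∎
    where
    open ≤-Reasoning
    earlier : ∀ {x} → x ∈ forcedWithin (suc s) → forcer x ∈ atMost s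
    earlier x∈ = ∈atMost⁺
      (≤-trans (forcer-earlier (forcedWithin-∉B x∈)) (pred-mono-≤ (forcedWithin-round x∈)))
    injective : ∀ {x y} → x ∈ forcedWithin (suc s) → y ∈ forcedWithin (suc s) →
                forcer x ≡ forcer y → x ≡ y
    injective x∈ y∈ = forcer-injective (forcedWithin-∉B x∈) (forcedWithin-∉B y∈)

  firstRound : Subset n
  firstRound = forcedWithin 1

  firstRound-forces : ∀ {x} → x ∈ firstRound → Forces 0 (forcer x) x
  firstRound-forces {x} x∈ = subst (λ r → Forces r (forcer x) x)
    (n≤0⇒n≡0 (pred-mono-≤ (forcedWithin-round x∈))) (forcer-forces (forcedWithin-∉B x∈))

  firstRound-nonempty : ∀ {w} → w ∉ B → ∃ λ x → x ∈ firstRound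
  firstRound-nonempty {w} w∉B with Fin.any? (_∈? firstRound)
  ... | yes found = found
  ... | no  none  = contradiction (noFirstRound⇒blue⊆B noForce t (allBlue w)) w∉B
    where
    noForce : ∀ {v x} → ¬ Forces 0 v x
    noForce {v} {x} forces@(_ , _ , _ , x∉B) =
      none (x , x∈p∩q⁺ (∈atMost⁺ (round-least (inj₂ (v , forces))) , x∉p⇒x∈∁p x∉B))

  FirstForcer : Fin n → Set
  FirstForcer v = ∃ λ x → x ∈ firstRound × forcer x ≡ v

  firstForcer? : Decidable FirstForcer
  firstForcer? v = Fin.any? (λ x → (x ∈? firstRound) ×-dec (forcer x Fin.≟ v))

  firstForcers : Subset n
  firstForcers = subsetOf firstForcer?

  firstForcer-blue : ∀ {v} → FirstForcer v → v ∈ B × (∀ u → Adj G v u → u ∈ B)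
  firstForcer-blue (x , x∈ , refl) with firstRound-forces x∈
  ... | (_ , forcer∈B , nbrs∈B , _) = forcer∈B , nbrs∈B

  κ+∣firstRound∣≤∣B∣ : ∀ {κ w} → IsConnectivity G κ → w ∉ B → κ + ∣ firstRound ∣ ≤ ∣ B ∣
  κ+∣firstRound∣≤∣B∣ {κ} {w} (_ , κ-minimum) w∉B = begin
    κ + ∣ firstRound ∣                               ≤⟨ +-mono-≤ (κ-minimum _ separated) counted ⟩
    ∣ B ∩ ∁ firstForcers ∣ + ∣ B ∩ firstForcers ∣   ≡⟨ ∣p∩∁q∣+∣p∩q∣≡∣p∣ B firstForcers ⟩
    ∣ B ∣                                            ∎
    where
    open ≤-Reasoning
    blue : ∀ {v} → v ∈ firstForcers → v ∈ B × (∀ u → Adj G v u → u ∈ B)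
    blue = firstForcer-blue ∘ ∈subsetOf⁻ firstForcer?
    found : ∃ λ x → x ∈ firstRound
    found = firstRound-nonempty w∉B
    separated : DisconnectedOrTrivial G (B ∩ ∁ firstForcers)
    separated = separates G (proj₁ ∘ blue) (λ y∈ → proj₂ (blue y∈) _)
      (∈subsetOf⁺ firstForcer? (proj₁ found , proj₂ found , refl)) w∉B
    counted : ∣ firstRound ∣ ≤ ∣ B ∩ firstForcers ∣
    counted = injectiveOn⇒∣p∣≤∣q∣ forcer
      (λ x∈ → x∈p∩q⁺ (proj₁ (firstForcer-blue (_ , x∈ , refl)) , ∈subsetOf⁺ firstForcer? (_ , x∈ , refl)))
      (λ x∈ y∈ → forcer-injective (forcedWithin-∉B x∈) (forcedWithin-∉B y∈))

  n+κ≤2∣B∣t : ∀ {κ} → IsConnectivity G κ → ∣ B ∣ < n → n + κ ≤ ∣ B ∣ * t + ∣ B ∣ * t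
  n+κ≤2∣B∣t conn ∣B∣<n with ∃∉⇐∣p∣<n ∣B∣<n
  ... | w , w∉B = n+κ≤2kt t
    (<-≤-trans (∉B⇒round>0 w∉B) (round-least (allBlue w)))
    (≤-trans (n≤∣atMost∣ ≤-refl) (∣atMost∣≤∣B∣*suc t))
    (λ t≤1 → ≤-trans (n≤∣atMost∣ t≤1) (∣p∣≤∣q∣+∣p∩∁q∣ (atMost 1) B))
    (κ+∣firstRound∣≤∣B∣ conn w∉B)

⌈n/2⌉≤m : ∀ {n m} → n ≤ m + m → ⌈ n /2⌉ ≤ m
⌈n/2⌉≤m {m = m} n≤m+m = ≤-trans (⌈n/2⌉-mono n≤m+m) (≤-reflexive (sym (n≡⌈n+n/2⌉ m)))

proposition4p10 : ∀ {n} (G : Graph n) (κ : ℕ) → IsConnectivity G κ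
    → ThStarAtLeast G ⌈ (n + κ) /2⌉
proposition4p10 {n} G κ conn ._
  (_ , k , t , _ , _ , k<n , ((B , ∣B∣≡k , ((L , chron , allBlue , _) , _)) , _) , refl) =
  ⌈n/2⌉≤m (subst (λ k → n + κ ≤ k * t + k * t) ∣B∣≡k
    (Rounds.n+κ≤2∣B∣t chron allBlue conn (subst (_< n) (sym ∣B∣≡k) k<n)))
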